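{- Let $c$ be a positive integer and let $(L,Q_1,\ldots,Q_n,R)$ be a $(4,c)$-flexipath in a matroid $M$. If $c\ge 4$, then $n\le 1$.
   Context: Let $M$ be a matroid on ground set $E$ with rank function $r$. $\lambda(A)=r(A)+r(E-A)-r(M)$; $\kappa(X,Y)=\min\{\lambda(Z):X\subseteq Z\subseteq E-Y\}$ for disjoint $X,Y$. A path of $4$-separations is an ordered partition $(L,P_1,\ldots,P_n,R)$ of $E$ with $\kappa(L,R)=3$ and $\lambda(L\cup P_1\cup\cdots\cup P_i)=3$ for all $i\in\{0,\ldots,n\}$; a $4$-flexipath if this holds for every reordering of $P_1,\ldots,P_n$ (with $L,R$ fixed); a $(4,c)$-flexipath if moreover $\lambda(P_i)=c$ for all $i$ and $\lambda(P_i\cup P_j)>c$ for all distinct $i,j$. -}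

module Defs where

open import Data.Nat using (ℕ; _≤_; _<_; _+_; _∸_)
open import Data.Fin using (Fin)
open import Data.Fin.Subset using (Subset; _⊆_; _∪_; _∩_; ∁; ⊥; ⊤; ⋃; ∣_∣)
open import Data.Fin.Permutation using (Permutation′; _⟨$⟩ʳ_)
open import Data.List using (List; take; tabulate)
open import Data.Product using (Σ; _×_; _,_)
open import Relation.Binary.PropositionalEquality using (_≡_; _≢_)
open import Level using (0ℓ)

record Matroid (m : ℕ) : Set where
  field
    r        : Subset m → ℕ
    r-bound  : ∀ X → r X ≤ ∣ X ∣
    r-mono   : ∀ X Y → X ⊆ Y → r X ≤ r Y
    r-submod : ∀ X Y → r (X ∪ Y) + r (X ∩ Y) ≤ r X + r Y

module _ {m : ℕ} (M : Matroid m) where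
  open Matroid M

  rM : ℕ
  rM = r ⊤

  -- λ(A) = r(A) + r(E - A) - r(M)   (never truncated, by submodularity)
  conn : Subset m → ℕ
  conn A = r A + r (∁ A) ∸ rM

  κ≡ : Subset m → Subset m → ℕ → Set
  κ≡ X Y k =
    Σ (Subset m) (λ Z → X ⊆ Z × Z ⊆ ∁ Y × conn Z ≡ k)
    × (∀ Z → X ⊆ Z → Z ⊆ ∁ Y → k ≤ conn Z)

prefixUnion : {m n : ℕ} → (Fin n → Subset m) → ℕ → Subset m
prefixUnion P i = ⋃ (take i (tabulate P))

IsOrderedPartition : {m n : ℕ} → Subset m → (Fin n → Subset m) → Subset m → Set
IsOrderedPartition {m} {n} L P R =
  (L ∩ R ≡ ⊥)
  × (∀ i → L ∩ P i ≡ ⊥)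
  × (∀ i → R ∩ P i ≡ ⊥)
  × (∀ i j → i ≢ j → P i ∩ P j ≡ ⊥)
  × (L ∪ (prefixUnion P n ∪ R) ≡ ⊤)

module _ {m : ℕ} (M : Matroid m) where

  IsPath4 : {n : ℕ} → Subset m → (Fin n → Subset m) → Subset m → Set
  IsPath4 {n} L P R =
    IsOrderedPartition L P R
    × κ≡ M L R 3
    × (∀ i → i ≤ n → conn M (L ∪ prefixUnion P i) ≡ 3)

  Is4Flexipath : {n : ℕ} → Subset m → (Fin n → Subset m) → Subset m → Set
  Is4Flexipath {n} L P R =
    ∀ (σ : Permutation′ n) → IsPath4 L (λ i → P (σ ⟨$⟩ʳ i)) R

  Is4cFlexipath : ℕ → {n : ℕ} → Subset m → (Fin n → Subset m) → Subset m → Set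
  Is4cFlexipath c L P R =
    Is4Flexipath L P R
    × (∀ i → conn M (P i) ≡ c)
    × (∀ i j → i ≢ j → c < conn M (P i ∪ P j))

{-# OPTIONS --safe #-}
-- λ is submodular and invariant under complementation, hence posimodular:
-- λ(X − Y) + λ(Y − X) ≤ λ(X) + λ(Y). If n ≥ 2, reordering the flexipath puts
-- either of Q₁, Q₂ directly after L, so λ(L ∪ Q₁) = λ(L ∪ Q₂) = 3; applying
-- posimodularity to X = L ∪ Q₁ and Y = L ∪ Q₂ gives 2c ≤ 6, i.e. c ≤ 3.
module Submission where

open import Defs
open import Data.Nat using (ℕ; zero; suc; _≤_; _+_; _∸_; z≤n; s≤s)
open import Data.Nat.Properties
  using (m≤m+n; m∸n+n≡m; +-comm; +-mono-≤; +-mono-<; +-cancelʳ-≤; <⇒≱;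
         +-commutativeSemigroup; module ≤-Reasoning)
open import Algebra.Properties.CommutativeSemigroup +-commutativeSemigroup using (interchange)
open import Data.Fin using (Fin) renaming (zero to 0F; suc to sucF)
open import Data.Fin.Subset using (Subset; _∈_; _∉_; _∪_; _∩_; ∁; ⊥)
open import Data.Fin.Subset.Properties
  using (⊆-antisym; ∉⊥; x∈p∩q⁺; x∈p∩q⁻; x∈p∪q⁺; x∈p∪q⁻; x∈∁p⇒x∉p; x∉p⇒x∈∁p;
         p∪∁p≡⊤; ∩-comm; ∪-identityʳ; ∪-∩-booleanAlgebra)
open import Data.Fin.Permutation using (id; transpose)
open import Data.Product using (_,_; proj₁; proj₂)
open import Data.Sum using (inj₁; inj₂)
open import Data.Empty using (⊥-elim)
open import Relation.Binary.PropositionalEquality using (_≡_; _≢_; sym; trans; cong; cong₂; subst; subst₂)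

module _ {m : ℕ} where

  x∈p∧p∩q≡⊥⇒x∉q : ∀ {p q : Subset m} {x} → x ∈ p → p ∩ q ≡ ⊥ → x ∉ q
  x∈p∧p∩q≡⊥⇒x∉q x∈p p∩q≡⊥ x∈q = ∉⊥ (subst (_ ∈_) p∩q≡⊥ (x∈p∩q⁺ (x∈p , x∈q)))

  [p∪q]∩∁[p∪r]≡q : ∀ {p q r : Subset m} → p ∩ q ≡ ⊥ → q ∩ r ≡ ⊥ → (p ∪ q) ∩ ∁ (p ∪ r) ≡ q
  [p∪q]∩∁[p∪r]≡q {p} {q} {r} p∩q≡⊥ q∩r≡⊥ = ⊆-antisym ⊆q q⊆
    where
    ⊆q : ∀ {x} → x ∈ (p ∪ q) ∩ ∁ (p ∪ r) → x ∈ q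
    ⊆q x∈ with x∈p∩q⁻ (p ∪ q) (∁ (p ∪ r)) x∈
    ... | x∈p∪q , x∈∁[p∪r] with x∈p∪q⁻ p q x∈p∪q
    ...   | inj₁ x∈p = ⊥-elim (x∈∁p⇒x∉p x∈∁[p∪r] (x∈p∪q⁺ (inj₁ x∈p)))
    ...   | inj₂ x∈q = x∈q
    q⊆ : ∀ {x} → x ∈ q → x ∈ (p ∪ q) ∩ ∁ (p ∪ r)
    q⊆ x∈q = x∈p∩q⁺ (x∈p∪q⁺ (inj₂ x∈q) , x∉p⇒x∈∁p x∉p∪r)
      where
      x∉p∪r : _ ∉ p ∪ r
      x∉p∪r x∈p∪r with x∈p∪q⁻ p r x∈p∪r
      ... | inj₁ x∈p = x∈p∧p∩q≡⊥⇒x∉q x∈p p∩q≡⊥ x∈q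
      ... | inj₂ x∈r = x∈p∧p∩q≡⊥⇒x∉q x∈q q∩r≡⊥ x∈r

module _ {m : ℕ} (M : Matroid m) where
  open Matroid M
  open import Algebra.Lattice.Properties.BooleanAlgebra (∪-∩-booleanAlgebra m)
    using (deMorgan₁; deMorgan₂; ¬-involutive)

  rM≤r+r∁ : ∀ A → rM M ≤ r A + r (∁ A)
  rM≤r+r∁ A = begin
    rM M                              ≡⟨ cong r (sym (p∪∁p≡⊤ A)) ⟩
    r (A ∪ ∁ A)                       ≤⟨ m≤m+n _ _ ⟩
    r (A ∪ ∁ A) + r (A ∩ ∁ A)         ≤⟨ r-submod A (∁ A) ⟩
    r A + r (∁ A)                     ∎
    where open ≤-Reasoning

  conn+rM≡r+r∁ : ∀ A → conn M A + rM M ≡ r A + r (∁ A)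
  conn+rM≡r+r∁ A = m∸n+n≡m (rM≤r+r∁ A)

  conn-∁ : ∀ A → conn M (∁ A) ≡ conn M A
  conn-∁ A = trans (cong (λ B → r (∁ A) + r B ∸ rM M) (¬-involutive A))
                   (cong (_∸ rM M) (+-comm (r (∁ A)) (r A)))

  conn-submod : ∀ X Y → conn M (X ∪ Y) + conn M (X ∩ Y) ≤ conn M X + conn M Y
  conn-submod X Y = +-cancelʳ-≤ (k + k) _ _ (begin
    (conn M (X ∪ Y) + conn M (X ∩ Y)) + (k + k)
      ≡⟨ interchange (conn M (X ∪ Y)) (conn M (X ∩ Y)) k k ⟩
    (conn M (X ∪ Y) + k) + (conn M (X ∩ Y) + k)
      ≡⟨ cong₂ _+_ (conn+rM≡r+r∁ (X ∪ Y)) (conn+rM≡r+r∁ (X ∩ Y)) ⟩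
    (r (X ∪ Y) + r (∁ (X ∪ Y))) + (r (X ∩ Y) + r (∁ (X ∩ Y)))
      ≡⟨ cong₂ (λ U V → (r (X ∪ Y) + r U) + (r (X ∩ Y) + r V)) (deMorgan₂ X Y) (deMorgan₁ X Y) ⟩
    (r (X ∪ Y) + r (∁ X ∩ ∁ Y)) + (r (X ∩ Y) + r (∁ X ∪ ∁ Y))
      ≡⟨ interchange (r (X ∪ Y)) (r (∁ X ∩ ∁ Y)) (r (X ∩ Y)) (r (∁ X ∪ ∁ Y)) ⟩
    (r (X ∪ Y) + r (X ∩ Y)) + (r (∁ X ∩ ∁ Y) + r (∁ X ∪ ∁ Y))
      ≡⟨ cong (r (X ∪ Y) + r (X ∩ Y) +_) (+-comm (r (∁ X ∩ ∁ Y)) (r (∁ X ∪ ∁ Y))) ⟩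
    (r (X ∪ Y) + r (X ∩ Y)) + (r (∁ X ∪ ∁ Y) + r (∁ X ∩ ∁ Y))
      ≤⟨ +-mono-≤ (r-submod X Y) (r-submod (∁ X) (∁ Y)) ⟩
    (r X + r Y) + (r (∁ X) + r (∁ Y))
      ≡⟨ interchange (r X) (r Y) (r (∁ X)) (r (∁ Y)) ⟩
    (r X + r (∁ X)) + (r Y + r (∁ Y))
      ≡⟨ sym (cong₂ _+_ (conn+rM≡r+r∁ X) (conn+rM≡r+r∁ Y)) ⟩
    (conn M X + k) + (conn M Y + k)
      ≡⟨ interchange (conn M X) k (conn M Y) k ⟩
    (conn M X + conn M Y) + (k + k) ∎)
    where
    open ≤-Reasoning
    k : ℕ
    k = rM M

  conn-posimod : ∀ X Y → conn M (X ∩ ∁ Y) + conn M (Y ∩ ∁ X) ≤ conn M X + conn M Y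
  conn-posimod X Y = begin
    conn M (X ∩ ∁ Y) + conn M (Y ∩ ∁ X)       ≡⟨ cong (conn M (X ∩ ∁ Y) +_) conn-Y∩∁X≡conn-X∪∁Y ⟩
    conn M (X ∩ ∁ Y) + conn M (X ∪ ∁ Y)       ≡⟨ +-comm (conn M (X ∩ ∁ Y)) (conn M (X ∪ ∁ Y)) ⟩
    conn M (X ∪ ∁ Y) + conn M (X ∩ ∁ Y)       ≤⟨ conn-submod X (∁ Y) ⟩
    conn M X + conn M (∁ Y)                   ≡⟨ cong (conn M X +_) (conn-∁ Y) ⟩
    conn M X + conn M Y                       ∎
    where
    open ≤-Reasoning
    conn-Y∩∁X≡conn-X∪∁Y : conn M (Y ∩ ∁ X) ≡ conn M (X ∪ ∁ Y)
    conn-Y∩∁X≡conn-X∪∁Y = begin-equality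
      conn M (Y ∩ ∁ X)         ≡⟨ cong (conn M) (∩-comm Y (∁ X)) ⟩
      conn M (∁ X ∩ Y)         ≡⟨ cong (λ Z → conn M (∁ X ∩ Z)) (sym (¬-involutive Y)) ⟩
      conn M (∁ X ∩ ∁ (∁ Y))   ≡⟨ cong (conn M) (sym (deMorgan₂ X (∁ Y))) ⟩
      conn M (∁ (X ∪ ∁ Y))     ≡⟨ conn-∁ (X ∪ ∁ Y) ⟩
      conn M (X ∪ ∁ Y)         ∎

  conn+conn≤conn-∪+conn-∪ : ∀ {L A B} → L ∩ A ≡ ⊥ → L ∩ B ≡ ⊥ → A ∩ B ≡ ⊥ →
                            conn M A + conn M B ≤ conn M (L ∪ A) + conn M (L ∪ B)
  conn+conn≤conn-∪+conn-∪ {L} {A} {B} L∩A≡⊥ L∩B≡⊥ A∩B≡⊥ =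
    subst₂ (λ U V → conn M U + conn M V ≤ conn M (L ∪ A) + conn M (L ∪ B))
      ([p∪q]∩∁[p∪r]≡q L∩A≡⊥ A∩B≡⊥)
      ([p∪q]∩∁[p∪r]≡q L∩B≡⊥ (trans (∩-comm B A) A∩B≡⊥))
      (conn-posimod (L ∪ A) (L ∪ B))

  module _ {n : ℕ} {L R : Subset m} {P : Fin (suc n) → Subset m}
           (flex : Is4Flexipath M L P R) where

    flexipath-conn-L∪P≡3 : ∀ i → conn M (L ∪ P i) ≡ 3
    flexipath-conn-L∪P≡3 i =
      trans (cong (λ Z → conn M (L ∪ Z)) (sym (∪-identityʳ (P i))))
            (proj₂ (proj₂ (flex (transpose 0F i))) 1 (s≤s z≤n))

    flexipath-conn-P+conn-P≤6 : ∀ {i j} → i ≢ j → conn M (P i) + conn M (P j) ≤ 3 + 3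
    flexipath-conn-P+conn-P≤6 {i} {j} i≢j =
      subst (conn M (P i) + conn M (P j) ≤_)
        (cong₂ _+_ (flexipath-conn-L∪P≡3 i) (flexipath-conn-L∪P≡3 j))
        (conn+conn≤conn-∪+conn-∪ (L∩P≡⊥ i) (L∩P≡⊥ j) (P∩P≡⊥ i j i≢j))
      where
      L∩P≡⊥ : ∀ k → L ∩ P k ≡ ⊥
      L∩P≡⊥ = proj₁ (proj₂ (proj₁ (flex id)))
      P∩P≡⊥ : ∀ k l → k ≢ l → P k ∩ P l ≡ ⊥
      P∩P≡⊥ = proj₁ (proj₂ (proj₂ (proj₂ (proj₁ (flex id)))))

lemma4p6 : (m : ℕ) (M : Matroid m) (c n : ℕ)
           (L : Subset m) (Q : Fin n → Subset m) (R : Subset m) →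
           1 ≤ c → Is4cFlexipath M c L Q R → 4 ≤ c → n ≤ 1
lemma4p6 m M c zero          L Q R _ _ _ = z≤n
lemma4p6 m M c (suc zero)    L Q R _ _ _ = s≤s z≤n
lemma4p6 m M c (suc (suc n)) L Q R _ (flex , conn-Q≡c , _) 4≤c =
  ⊥-elim (<⇒≱ (+-mono-< 4≤c 4≤c) c+c≤3+3)
  where
  c+c≤3+3 : c + c ≤ 3 + 3
  c+c≤3+3 = subst (_≤ 3 + 3) (cong₂ _+_ (conn-Q≡c 0F) (conn-Q≡c (sucF 0F)))
              (flexipath-conn-P+conn-P≤6 M {P = Q} flex {0F} {sucF 0F} (λ ()))
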